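{- Let $P$ be a non-empty set and $\mathcal{L}$ a set of formulae with semantic function $[\![\cdot]\!]:\mathcal{L}\to\mathcal{P}(P)$ such that $\mathcal{L}(p)\neq\emptyset$ for every $p\in P$. Suppose $\mathcal{L}$ is finitely characterized by $\mathcal{B}$ for some monotonic $\mathcal{B}$. Then for each consistent $\phi\in\mathcal{L}$, the set $[\![\phi]\!]$ has a minimal element.
   Context: For $p\in P$, $\mathcal{L}(p)=\{\phi\in\mathcal{L}\mid p\in[\![\phi]\!]\}$. A formula is consistent iff its denotation is non-empty. For $S\subseteq P$, $p\in S$ is minimal in $S$ iff for each $q\in S$, $\mathcal{L}(q)\subseteq\mathcal{L}(p)$ implies $\mathcal{L}(q)=\mathcal{L}(p)$. $\mathcal{L}$ is characterized by $\mathcal{B}:P\to\mathcal{P}(\mathcal{L})$ iff for each $p\in P$: $\emptyset\subsetneq\mathcal{B}(p)\subseteq\mathcal{L}(p)$ and for each $\phi\in\mathcal{L}(p)$, $\bigcap_{\psi\in\mathcal{B}(p)}[\![\psi]\!]\subseteq[\![\phi]\!]$; finitely characterized if moreover each $\mathcal{B}(p)$ is finite. $\mathcal{B}$ is monotonic iff $\mathcal{L}(p)\subseteq\mathcal{L}(q)$ implies $\mathcal{B}(p)\subseteq\mathcal{B}(q)$ for all $p,q\in P$. -}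

module Defs where

open import Data.Product using (Σ; ∃; _×_; _,_)
open import Data.List using (List)
open import Data.List.Membership.Propositional using (_∈_)
open import Function.Bundles using (_⇔_)

Subset : Set → Set₁
Subset A = A → Set

_⊆_ : {A : Set} → Subset A → Subset A → Set
S ⊆ T = ∀ {x} → S x → T x

_≐_ : {A : Set} → Subset A → Subset A → Set
S ≐ T = (S ⊆ T) × (T ⊆ S)

FiniteSubset : {A : Set} → Subset A → Set
FiniteSubset {A} S = Σ (List A) λ xs → ∀ x → S x ⇔ (x ∈ xs)

-- A set of points P, a set of formulae L, a semantic function
-- ⟦_⟧ : L → 𝒫(P), given as  sem φ p  meaning  p ∈ ⟦φ⟧.
module Semantics {P L : Set} (sem : L → Subset P) where

  Lof : P → Subset L
  Lof p φ = sem φ p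

  Consistent : L → Set
  Consistent φ = ∃ λ p → sem φ p

  Minimal : Subset P → P → Set
  Minimal S p = S p × (∀ q → S q → Lof q ⊆ Lof p → Lof q ≐ Lof p)

  BigInter : Subset L → Subset P
  BigInter X p = ∀ ψ → X ψ → sem ψ p

  CharacterizedBy : (P → Subset L) → Set
  CharacterizedBy B = ∀ p →
      (∃ λ ψ → B p ψ)
    × (B p ⊆ Lof p)
    × (∀ φ → Lof p φ → BigInter (B p) ⊆ sem φ)

  FinitelyCharacterizedBy : (P → Subset L) → Set
  FinitelyCharacterizedBy B = CharacterizedBy B × (∀ p → FiniteSubset (B p))

  Monotonic : (P → Subset L) → Set
  Monotonic B = ∀ p q → Lof p ⊆ Lof q → B p ⊆ B q

{-# OPTIONS --safe #-}
module Submission where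

open import Defs
open import Data.Product using (∃; _×_; _,_; proj₁; proj₂)
open import Axiom.ExcludedMiddle using (ExcludedMiddle)
open import Axiom.DoubleNegationElimination using (em⇒dne)
open import Level using (0ℓ)
open import Data.List using (List; []; _∷_)
open import Data.List.Membership.Propositional using (_∈_)
open import Data.List.Relation.Unary.Any using (here; there)
open import Data.Sum using (inj₁; inj₂)
open import Data.Empty using (⊥-elim)
open import Relation.Nullary using (¬_; yes; no)
open import Relation.Unary using (_∪_)
open import Relation.Binary.PropositionalEquality using (refl)
open import Function.Bundles using (Equivalence)

-- Descent from a point p of S to points q of S with 𝓛(q) ⊆ 𝓛(p). By monotonicity
-- 𝓑(q) ⊆ 𝓑(p), so only the finitely many formulae of 𝓑(p) can be lost on the way.
-- Going through them one at a time, each ψ is either dropped by some q below the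
-- current point (move there, ψ is gone for good) or kept by all of them. Once every
-- formula is kept, 𝓑(p) ⊆ 𝓑(q) for all q below p, and since 𝓑 characterizes 𝓛
-- this gives 𝓛(p) ⊆ 𝓛(q), i.e. p is minimal.

module _ {P L : Set} {sem : L → Subset P} {B : P → Subset L}
         (ch : Semantics.CharacterizedBy sem B) where
  open Semantics sem

  B⊆⇒Lof⊆ : ∀ {p q} → B p ⊆ B q → Lof p ⊆ Lof q
  B⊆⇒Lof⊆ {p} {q} Bp⊆Bq {χ} χ∈Lp =
    proj₂ (proj₂ (ch p)) χ χ∈Lp λ ψ ψ∈Bp → proj₁ (proj₂ (ch q)) (Bp⊆Bq ψ∈Bp)

  module Descent (S : Subset P) where

    Below : P → P → Set
    Below q p = S q × Lof q ⊆ Lof p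

    Persistent : P → Subset L
    Persistent p ψ = ∀ q → Below q p → B q ψ

    Persistent-antitone : ∀ {p q} → Lof q ⊆ Lof p → Persistent p ⊆ Persistent q
    Persistent-antitone Lq⊆Lp ψ-pers r (Sr , Lr⊆Lq) = ψ-pers r (Sr , λ χ → Lq⊆Lp (Lr⊆Lq χ))

    minimal-if-B⊆Persistent : ∀ {p} → S p → B p ⊆ Persistent p → Minimal S p
    minimal-if-B⊆Persistent Sp Bp⊆pers = Sp , λ q Sq Lq⊆Lp →
      Lq⊆Lp , B⊆⇒Lof⊆ λ ψ∈Bp → Bp⊆pers ψ∈Bp q (Sq , Lq⊆Lp)

    descend : ExcludedMiddle 0ℓ → Monotonic B →
              (ys : List L) {p : P} → S p → B p ⊆ (Persistent p ∪ (_∈ ys)) → ∃ (Minimal S)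
    descend em mono [] {p} Sp Bp⊆ = p , minimal-if-B⊆Persistent Sp persistent
      where
      persistent : B p ⊆ Persistent p
      persistent ψ∈Bp with Bp⊆ ψ∈Bp
      ... | inj₁ ψ-pers = ψ-pers
    descend em mono (y ∷ ys) {p} Sp Bp⊆ with em {∃ λ q → Below q p × ¬ B q y}
    ... | yes (q , (Sq , Lq⊆Lp) , y∉Bq) = descend em mono ys Sq Bq⊆
      where
      Bq⊆ : B q ⊆ (Persistent q ∪ (_∈ ys))
      Bq⊆ ψ∈Bq with Bp⊆ (mono q p Lq⊆Lp ψ∈Bq)
      ... | inj₁ ψ-pers         = inj₁ (Persistent-antitone Lq⊆Lp ψ-pers)
      ... | inj₂ (here refl)    = ⊥-elim (y∉Bq ψ∈Bq)
      ... | inj₂ (there ψ∈ys)   = inj₂ ψ∈ys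
    ... | no no-drop = descend em mono ys Sp Bp⊆′
      where
      y-persistent : Persistent p y
      y-persistent q q-below = em⇒dne em λ y∉Bq → no-drop (q , q-below , y∉Bq)

      Bp⊆′ : B p ⊆ (Persistent p ∪ (_∈ ys))
      Bp⊆′ ψ∈Bp with Bp⊆ ψ∈Bp
      ... | inj₁ ψ-pers         = inj₁ ψ-pers
      ... | inj₂ (here refl)    = inj₁ y-persistent
      ... | inj₂ (there ψ∈ys)   = inj₂ ψ∈ys

mainTheorem13 : ExcludedMiddle 0ℓ →
    {P L : Set} (sem : L → Subset P) →
    P →
    (∀ p → ∃ λ φ → Semantics.Lof sem p φ) →
    (B : P → Subset L) →
    Semantics.FinitelyCharacterizedBy sem B →
    Semantics.Monotonic sem B →
    ∀ φ → Semantics.Consistent sem φ →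
    ∃ λ p → Semantics.Minimal sem (sem φ) p
mainTheorem13 em sem _ _ B (ch , finite) mono φ (p₀ , φp₀) =
  Descent.descend ch (sem φ) em mono (proj₁ (finite p₀)) φp₀
    (λ ψ∈Bp₀ → inj₂ (Equivalence.to (proj₂ (finite p₀) _) ψ∈Bp₀))
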